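{- Let $S$ be a Steiner triple system on $m$ vertices, let $c\ge1$ be an integer (the paper considers $c\le d$ for a fixed $d$), and let $v_1,\dots,v_c\in V(S)$ be distinct vertices. Then there are $s(c)=\frac{m}{c^2+1}$ (i.e. at least $\lfloor m/(c^2+1)\rfloor$) stars $S_1,\dots,S_{s(c)}$ such that (1) for each $l$, $S_l=\{\{v_i,w_i^{(l)},u^{(l)}\}:1\le i\le c\}\subseteq E(S)$ is a star centered at $u^{(l)}$, i.e. these are edges of $S$ and the $2c+1$ vertices $v_1,\dots,v_c,w_1^{(l)},\dots,w_c^{(l)},u^{(l)}$ are distinct; (2) the sets $W_l=\{w_1^{(l)},\dots,w_c^{(l)},u^{(l)}\}$, $l=1,\dots,s(c)$, are pairwise disjoint subsets of $V(S)$.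
   Context: A Steiner triple system is a $3$-uniform hypergraph in which every pair of vertices is contained in exactly one edge. -}

module Defs where

open import Data.Nat using (ℕ)
open import Data.Fin using (Fin)
open import Data.Fin.Subset using (Subset; _∈_; ∣_∣; ⁅_⁆; _∪_)
open import Data.Product using (Σ; _×_; ∃)
open import Relation.Binary.PropositionalEquality using (_≡_; _≢_)

record Hypergraph3 (m : ℕ) : Set₁ where
  field
    Edge    : Subset m → Set
    uniform : ∀ e → Edge e → ∣ e ∣ ≡ 3

record SteinerTripleSystem (m : ℕ) : Set₁ where
  field
    hypergraph : Hypergraph3 m
  open Hypergraph3 hypergraph public
  field
    pair-covered : ∀ (x y : Fin m) → x ≢ y →
      ∃ λ e → Edge e × x ∈ e × y ∈ e
    pair-unique  : ∀ (x y : Fin m) → x ≢ y → ∀ e e' →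
      Edge e → x ∈ e → y ∈ e → Edge e' → x ∈ e' → y ∈ e' → e ≡ e'

triple : ∀ {m} → Fin m → Fin m → Fin m → Subset m
triple a b c = ⁅ a ⁆ ∪ (⁅ b ⁆ ∪ ⁅ c ⁆)

-- Write third x y for the third point of the line through x ≠ y, and call
-- u admissible if it avoids the c² points v i and third (v i) (v j), i ≠ j.
-- An admissible u is the centre of a star with leaves third (v i) u, and a
-- star is disjoint from an admissible one at u' as soon as its centre avoids
-- the 1 + c² points u', third (v i) u' and third (v j) (third (v i) u'),
-- i ≠ j: if two leaves or a leaf and a centre coincide, applying third (v i)
-- recovers u from one of these points.  So the stars can be chosen greedily:
-- after l of them at most c² + l(c² + 1) points are excluded, and a new
-- centre exists as long as this is less than m.

module Submission where

open import Defs
open import Data.Nat using (ℕ; suc; _≥_; _*_; _/_)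
open import Data.Fin using (Fin)
open import Data.Product using (Σ; _×_)
open import Function.Definitions using (Injective)
open import Relation.Binary.PropositionalEquality using (_≡_; _≢_)

open import Data.Nat using (zero; _+_; _≤_; _<_; z≤n; s≤s)
open import Data.Nat.Properties using (≤-trans; ≤-reflexive; +-suc; n≤1+n; m≤n+m; <⇒≱; module ≤-Reasoning)
open import Data.Nat.DivMod using (m/n*n≤m)
open import Data.Fin using (zero; suc; _≟_; punchIn; punchOut; combine; _↑ˡ_; _↑ʳ_)
open import Data.Fin.Properties using (punchIn-punchOut; remQuot-combine; ¬∀⟶∃¬; injective⇒≤; any?)
open import Data.Fin.Subset using (Subset; inside; outside; ⁅_⁆; _∪_; ∣_∣; _⊆_; _∈_; _∉_)
open import Data.Fin.Subset.Properties using (_∈?_; x∈⁅x⁆; x∈⁅y⁆⇒x≡y; x≢y⇒x∉⁅y⁆; ∣⁅x⁆∣≡1; x∈p∪q⁺; x∈p∪q⁻; q⊆p∪q; ⊆-antisym; p⊆q⇒∣p∣≤∣q∣; p⊂q⇒∣p∣<∣q∣)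
open import Data.Vec using ([]; _∷_)
open import Data.Vec.Functional as Vector using (Vector; _++_; concat)
open import Data.Vec.Functional.Properties using (lookup-++ˡ; lookup-++ʳ)
open import Data.Vec.Functional.Relation.Unary.Any using (Any; any)
open import Data.Product using (_,_; proj₁; proj₂; ∃; uncurry)
open import Data.Sum using (_⊎_; inj₁; inj₂)
open import Function using (_∘_)
open import Relation.Nullary using (¬_; yes; no; contradiction)
open import Relation.Nullary.Decidable using (_×-dec_; ¬?)
open import Relation.Binary.PropositionalEquality using (refl; sym; trans; cong; cong₂; subst; ≢-sym; module ≡-Reasoning)

∣p∪q∣≤∣p∣+∣q∣ : ∀ {n} (p q : Subset n) → ∣ p ∪ q ∣ ≤ ∣ p ∣ + ∣ q ∣
∣p∪q∣≤∣p∣+∣q∣ []            []            = z≤n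
∣p∪q∣≤∣p∣+∣q∣ (inside  ∷ p) (inside  ∷ q) =
  s≤s (≤-trans (≤-trans (∣p∪q∣≤∣p∣+∣q∣ p q) (n≤1+n _)) (≤-reflexive (sym (+-suc ∣ p ∣ ∣ q ∣))))
∣p∪q∣≤∣p∣+∣q∣ (inside  ∷ p) (outside ∷ q) = s≤s (∣p∪q∣≤∣p∣+∣q∣ p q)
∣p∪q∣≤∣p∣+∣q∣ (outside ∷ p) (inside  ∷ q) =
  ≤-trans (s≤s (∣p∪q∣≤∣p∣+∣q∣ p q)) (≤-reflexive (sym (+-suc ∣ p ∣ ∣ q ∣)))
∣p∪q∣≤∣p∣+∣q∣ (outside ∷ p) (outside ∷ q) = ∣p∪q∣≤∣p∣+∣q∣ p q

module _ {n : ℕ} where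

  x∉p⇒∣p∣<∣⁅x⁆∪p∣ : ∀ {x : Fin n} {p} → x ∉ p → ∣ p ∣ < ∣ ⁅ x ⁆ ∪ p ∣
  x∉p⇒∣p∣<∣⁅x⁆∪p∣ {x} {p} x∉p = p⊂q⇒∣p∣<∣q∣ (q⊆p∪q ⁅ x ⁆ p , x , x∈p∪q⁺ (inj₁ (x∈⁅x⁆ x)) , x∉p)

  p⊆q∧∣q∣≤∣p∣⇒p≡q : ∀ {p q : Subset n} → p ⊆ q → ∣ q ∣ ≤ ∣ p ∣ → p ≡ q
  p⊆q∧∣q∣≤∣p∣⇒p≡q {p} {q} p⊆q ∣q∣≤∣p∣ = ⊆-antisym p⊆q q⊆p
    where
    q⊆p : q ⊆ p
    q⊆p {x} x∈q with x ∈? p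
    ... | yes x∈p = x∈p
    ... | no  x∉p = contradiction ∣q∣≤∣p∣ (<⇒≱ (p⊂q⇒∣p∣<∣q∣ (p⊆q , x , x∈q , x∉p)))

  2<∣p∣⇒∃-other : ∀ {p : Subset n} → 2 < ∣ p ∣ → ∀ x y → ∃ λ z → z ∈ p × z ≢ x × z ≢ y
  2<∣p∣⇒∃-other {p} 2<∣p∣ x y with any? (λ z → z ∈? p ×-dec ¬? (z ≟ x) ×-dec ¬? (z ≟ y))
  ... | yes other = other
  ... | no  none  = contradiction ∣p∣≤2 (<⇒≱ 2<∣p∣)
    where
    p⊆⁅x⁆∪⁅y⁆ : p ⊆ ⁅ x ⁆ ∪ ⁅ y ⁆
    p⊆⁅x⁆∪⁅y⁆ {z} z∈p with z ≟ x | z ≟ y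
    ... | yes refl | _        = x∈p∪q⁺ (inj₁ (x∈⁅x⁆ z))
    ... | no  _    | yes refl = x∈p∪q⁺ (inj₂ (x∈⁅x⁆ z))
    ... | no  z≢x  | no  z≢y  = contradiction (z , z∈p , z≢x , z≢y) none

    open ≤-Reasoning
    ∣p∣≤2 : ∣ p ∣ ≤ 2
    ∣p∣≤2 = begin
      ∣ p ∣                   ≤⟨ p⊆q⇒∣p∣≤∣q∣ p⊆⁅x⁆∪⁅y⁆ ⟩
      ∣ ⁅ x ⁆ ∪ ⁅ y ⁆ ∣       ≤⟨ ∣p∪q∣≤∣p∣+∣q∣ ⁅ x ⁆ ⁅ y ⁆ ⟩
      ∣ ⁅ x ⁆ ∣ + ∣ ⁅ y ⁆ ∣   ≡⟨ cong₂ _+_ (∣⁅x⁆∣≡1 x) (∣⁅x⁆∣≡1 y) ⟩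
      2                       ∎

module _ {n : ℕ} {a b c : Fin n} where

  a∈triple : a ∈ triple a b c
  a∈triple = x∈p∪q⁺ (inj₁ (x∈⁅x⁆ a))

  b∈triple : b ∈ triple a b c
  b∈triple = x∈p∪q⁺ (inj₂ (x∈p∪q⁺ (inj₁ (x∈⁅x⁆ b))))

  c∈triple : c ∈ triple a b c
  c∈triple = x∈p∪q⁺ (inj₂ (x∈p∪q⁺ (inj₂ (x∈⁅x⁆ c))))

  ∈triple⁻ : ∀ {x} → x ∈ triple a b c → x ≡ a ⊎ x ≡ b ⊎ x ≡ c
  ∈triple⁻ x∈abc with x∈p∪q⁻ ⁅ a ⁆ _ x∈abc
  ... | inj₁ x∈a = inj₁ (x∈⁅y⁆⇒x≡y a x∈a)
  ... | inj₂ x∈bc with x∈p∪q⁻ ⁅ b ⁆ ⁅ c ⁆ x∈bc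
  ...   | inj₁ x∈b = inj₂ (inj₁ (x∈⁅y⁆⇒x≡y b x∈b))
  ...   | inj₂ x∈c = inj₂ (inj₂ (x∈⁅y⁆⇒x≡y c x∈c))

  ∈triple-≢⇒≡ : ∀ {x} → x ∈ triple a b c → x ≢ a → x ≢ b → x ≡ c
  ∈triple-≢⇒≡ x∈abc x≢a x≢b with ∈triple⁻ x∈abc
  ... | inj₁ x≡a        = contradiction x≡a x≢a
  ... | inj₂ (inj₁ x≡b) = contradiction x≡b x≢b
  ... | inj₂ (inj₂ x≡c) = x≡c

  triple⊆ : ∀ {p} → a ∈ p → b ∈ p → c ∈ p → triple a b c ⊆ p
  triple⊆ a∈p b∈p c∈p x∈abc with ∈triple⁻ x∈abc
  ... | inj₁ refl        = a∈p
  ... | inj₂ (inj₁ refl) = b∈p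
  ... | inj₂ (inj₂ refl) = c∈p

  3≤∣triple∣ : a ≢ b → a ≢ c → b ≢ c → 3 ≤ ∣ triple a b c ∣
  3≤∣triple∣ a≢b a≢c b≢c = ≤-trans (s≤s 2≤∣bc∣) (x∉p⇒∣p∣<∣⁅x⁆∪p∣ a∉bc)
    where
    2≤∣bc∣ : 2 ≤ ∣ ⁅ b ⁆ ∪ ⁅ c ⁆ ∣
    2≤∣bc∣ = subst (λ k → suc k ≤ ∣ ⁅ b ⁆ ∪ ⁅ c ⁆ ∣) (∣⁅x⁆∣≡1 c) (x∉p⇒∣p∣<∣⁅x⁆∪p∣ (x≢y⇒x∉⁅y⁆ b≢c))
    a∉bc : a ∉ ⁅ b ⁆ ∪ ⁅ c ⁆
    a∉bc a∈bc with x∈p∪q⁻ ⁅ b ⁆ ⁅ c ⁆ a∈bc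
    ... | inj₁ a∈b = x≢y⇒x∉⁅y⁆ a≢b a∈b
    ... | inj₂ a∈c = x≢y⇒x∉⁅y⁆ a≢c a∈c

  ∣p∣≡3⇒triple≡p : ∀ {p} → ∣ p ∣ ≡ 3 → a ∈ p → b ∈ p → c ∈ p →
                   a ≢ b → a ≢ c → b ≢ c → triple a b c ≡ p
  ∣p∣≡3⇒triple≡p ∣p∣≡3 a∈p b∈p c∈p a≢b a≢c b≢c =
    p⊆q∧∣q∣≤∣p∣⇒p≡q (triple⊆ a∈p b∈p c∈p) (≤-trans (≤-reflexive ∣p∣≡3) (3≤∣triple∣ a≢b a≢c b≢c))

module ThirdPoint {m : ℕ} (S : SteinerTripleSystem m) where
  open SteinerTripleSystem S

  line : ∀ {x y} → x ≢ y → Σ (Fin m) λ z → Edge (triple x z y) × z ≢ x × z ≢ y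
  line {x} {y} x≢y =
    let e , edge , x∈e , y∈e = pair-covered x y x≢y
        z , z∈e , z≢x , z≢y  = 2<∣p∣⇒∃-other (≤-reflexive (sym (uniform e edge))) x y
    in z , subst Edge (sym (∣p∣≡3⇒triple≡p (uniform e edge) x∈e z∈e y∈e (≢-sym z≢x) x≢y z≢y)) edge
         , z≢x , z≢y

  -- junk value x when x ≡ y
  third : Fin m → Fin m → Fin m
  third x y with x ≟ y
  ... | yes _   = x
  ... | no  x≢y = proj₁ (line x≢y)

  third-line : ∀ {x y} → x ≢ y → Edge (triple x (third x y) y) × third x y ≢ x × third x y ≢ y
  third-line {x} {y} x≢y with x ≟ y
  ... | yes x≡y = contradiction x≡y x≢y
  ... | no  x≢y = proj₂ (line x≢y)

  third-edge : ∀ {x y} → x ≢ y → Edge (triple x (third x y) y)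
  third-edge = proj₁ ∘ third-line

  third≢ˡ : ∀ {x y} → x ≢ y → third x y ≢ x
  third≢ˡ = proj₁ ∘ proj₂ ∘ third-line

  third≢ʳ : ∀ {x y} → x ≢ y → third x y ≢ y
  third≢ʳ = proj₂ ∘ proj₂ ∘ third-line

  third-unique : ∀ {e a b c} → Edge e → a ∈ e → b ∈ e → c ∈ e →
                 a ≢ b → a ≢ c → b ≢ c → third a b ≡ c
  third-unique {e} {a} {b} {c} edge a∈e b∈e c∈e a≢b a≢c b≢c =
    ∈triple-≢⇒≡ (subst (third a b ∈_) line≡abc b∈triple) (third≢ˡ a≢b) (third≢ʳ a≢b)
    where
    line≡abc : triple a (third a b) b ≡ triple a b c
    line≡abc = trans (pair-unique a b a≢b _ e (third-edge a≢b) a∈triple c∈triple edge a∈e b∈e)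
                     (sym (∣p∣≡3⇒triple≡p (uniform e edge) a∈e b∈e c∈e a≢b a≢c b≢c))

  third-involutive : ∀ {x y} → x ≢ y → third x (third x y) ≡ y
  third-involutive x≢y =
    third-unique (third-edge x≢y) a∈triple b∈triple c∈triple
                 (≢-sym (third≢ˡ x≢y)) x≢y (third≢ʳ x≢y)

  third-rotate : ∀ {x y} → x ≢ y → third y (third x y) ≡ x
  third-rotate x≢y =
    third-unique (third-edge x≢y) c∈triple b∈triple a∈triple
                 (≢-sym (third≢ʳ x≢y)) (≢-sym x≢y) (third≢ˡ x≢y)

module _ {A : Set} where

  infix 4 _∈ᵛ_ _∉ᵛ_

  _∈ᵛ_ : A → ∀ {k} → Vector A k → Set
  x ∈ᵛ xs = Any (_≡ x) xs

  _∉ᵛ_ : A → ∀ {k} → Vector A k → Set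
  x ∉ᵛ xs = ¬ x ∈ᵛ xs

  ∈ᵛ-∷⁺ : ∀ {x k} y {xs : Vector A k} → x ∈ᵛ xs → x ∈ᵛ y Vector.∷ xs
  ∈ᵛ-∷⁺ y (i , xsᵢ≡x) = suc i , xsᵢ≡x

  module _ {x : A} {k l : ℕ} where

    ∈ᵛ-++⁺ˡ : ∀ {xs : Vector A k} (ys : Vector A l) → x ∈ᵛ xs → x ∈ᵛ xs ++ ys
    ∈ᵛ-++⁺ˡ {xs} ys (i , xsᵢ≡x) = i ↑ˡ l , trans (lookup-++ˡ xs ys i) xsᵢ≡x

    ∈ᵛ-++⁺ʳ : ∀ (xs : Vector A k) {ys : Vector A l} → x ∈ᵛ ys → x ∈ᵛ xs ++ ys
    ∈ᵛ-++⁺ʳ xs {ys} (i , ysᵢ≡x) = k ↑ʳ i , trans (lookup-++ʳ xs ys i) ysᵢ≡x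

    ∈ᵛ-concat⁺ : ∀ (xss : Vector (Vector A k) l) j → x ∈ᵛ xss j → x ∈ᵛ concat xss
    ∈ᵛ-concat⁺ xss j (i , xssⱼᵢ≡x) =
      combine j i , trans (cong (uncurry xss) (remQuot-combine j i)) xssⱼᵢ≡x

∃∉ᵛ : ∀ {k n} → k < n → (xs : Vector (Fin n) k) → ∃ λ x → x ∉ᵛ xs
∃∉ᵛ {k} {n} k<n xs = ¬∀⟶∃¬ n (_∈ᵛ xs) (λ x → any (_≟ x) xs) not-surjective
  where
  not-surjective : ¬ (∀ x → x ∈ᵛ xs)
  not-surjective cover = <⇒≱ k<n (injective⇒≤ preimage-injective)
    where
    preimage-injective : Injective _≡_ _≡_ (proj₁ ∘ cover)
    preimage-injective {x} {y} eq = trans (sym (proj₂ (cover x))) (trans (cong xs eq) (proj₂ (cover y)))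

module Stars {m : ℕ} (S : SteinerTripleSystem m)
             {n : ℕ} (v : Fin (suc n) → Fin m) (v-injective : Injective _≡_ _≡_ v) where
  open SteinerTripleSystem S using (Edge)
  open ThirdPoint S

  leaf : Fin m → Fin (suc n) → Fin m
  leaf u i = third (v i) u

  fanAt : Vector (Fin m) (suc n) → Fin (suc n) → Vector (Fin m) (suc n)
  fanAt a j = a j Vector.∷ λ t → third (v (punchIn j t)) (a j)

  fan : Vector (Fin m) (suc n) → Vector (Fin m) (suc n * suc n)
  fan a = concat (fanAt a)

  shadow : Fin m → Vector (Fin m) (suc (suc n * suc n))
  shadow u = u Vector.∷ fan (leaf u)

  ∈-fan : ∀ {x} a j → a j ≡ x → x ∈ᵛ fan a
  ∈-fan a j aⱼ≡x = ∈ᵛ-concat⁺ (fanAt a) j (zero , aⱼ≡x)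

  third∈fan : ∀ {x} a {i j} → i ≢ j → third (v i) (a j) ≡ x → x ∈ᵛ fan a
  third∈fan a {i} {j} i≢j eq = ∈ᵛ-concat⁺ (fanAt a) j (suc (punchOut (≢-sym i≢j)) ,
    trans (cong (λ k → third (v k) (a j)) (punchIn-punchOut (≢-sym i≢j))) eq)

  module _ {u : Fin m} (u∉fan : u ∉ᵛ fan v) where

    centre≢v : ∀ i → u ≢ v i
    centre≢v i u≡vᵢ = u∉fan (∈-fan v i (sym u≡vᵢ))

    leaf-edge : ∀ i → Edge (triple (v i) (leaf u i) u)
    leaf-edge i = third-edge (≢-sym (centre≢v i))

    centre≢leaf : ∀ i → u ≢ leaf u i
    centre≢leaf i = ≢-sym (third≢ʳ (≢-sym (centre≢v i)))

    third-leaf : ∀ i → third (v i) (leaf u i) ≡ u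
    third-leaf i = third-involutive (≢-sym (centre≢v i))

    leaf-injective : Injective _≡_ _≡_ (leaf u)
    leaf-injective {i} {j} leafᵢ≡leafⱼ = v-injective (begin
      v i                ≡⟨ third-rotate (≢-sym (centre≢v i)) ⟨
      third u (leaf u i) ≡⟨ cong (third u) leafᵢ≡leafⱼ ⟩
      third u (leaf u j) ≡⟨ third-rotate (≢-sym (centre≢v j)) ⟩
      v j                ∎)
      where open ≡-Reasoning

    v≢leaf : ∀ i j → v i ≢ leaf u j
    v≢leaf i j vᵢ≡leafⱼ with i ≟ j
    ... | yes refl = third≢ˡ (≢-sym (centre≢v i)) (sym vᵢ≡leafⱼ)
    ... | no  i≢j  = u∉fan (third∈fan v (≢-sym i≢j)
                       (trans (cong (third (v j)) vᵢ≡leafⱼ) (third-leaf j)))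

  StarsDisjoint : Fin m → Fin m → Set
  StarsDisjoint u u' = (∀ i j → leaf u i ≢ leaf u' j) × (∀ i → leaf u i ≢ u') × u ≢ u'

  stars-disjoint : ∀ {u u'} → u ∉ᵛ fan v → u' ∉ᵛ fan v → u ∉ᵛ shadow u' →
                   StarsDisjoint u u' × StarsDisjoint u' u
  stars-disjoint {u} {u'} u∉fan u'∉fan u∉shadow =
    (leaves-disjoint , leaf≢centre' , centres-distinct) ,
    ((λ i j → ≢-sym (leaves-disjoint j i)) , leaf'≢centre , ≢-sym centres-distinct)
    where
    centres-distinct : u ≢ u'
    centres-distinct u≡u' = u∉shadow (zero , sym u≡u')

    leaf'≢centre : ∀ i → leaf u' i ≢ u
    leaf'≢centre i leaf'ᵢ≡u = u∉shadow (∈ᵛ-∷⁺ u' (∈-fan (leaf u') i leaf'ᵢ≡u))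

    leaf≢centre' : ∀ i → leaf u i ≢ u'
    leaf≢centre' i leafᵢ≡u' =
      leaf'≢centre i (trans (cong (third (v i)) (sym leafᵢ≡u')) (third-leaf u∉fan i))

    leaves-disjoint : ∀ i j → leaf u i ≢ leaf u' j
    leaves-disjoint i j leafᵢ≡leaf'ⱼ with i ≟ j
    ... | yes refl = centres-distinct (begin
      u                     ≡⟨ third-leaf u∉fan i ⟨
      third (v i) (leaf u i)  ≡⟨ cong (third (v i)) leafᵢ≡leaf'ⱼ ⟩
      third (v i) (leaf u' i) ≡⟨ third-leaf u'∉fan i ⟩
      u'                    ∎)
      where open ≡-Reasoning
    ... | no  i≢j  = u∉shadow (∈ᵛ-∷⁺ u' (third∈fan (leaf u') i≢j
                       (trans (cong (third (v i)) (sym leafᵢ≡leaf'ⱼ)) (third-leaf u∉fan i))))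

  record StarPacking (k : ℕ) : Set where
    field
      centre     : Fin k → Fin m
      admissible : ∀ l → centre l ∉ᵛ fan v
      disjoint   : ∀ l l' → l ≢ l' → StarsDisjoint (centre l) (centre l')

  open StarPacking

  forbidden : ∀ {k} → StarPacking k → Vector (Fin m) (suc n * suc n + k * suc (suc n * suc n))
  forbidden P = fan v ++ concat (shadow ∘ centre P)

  extend : ∀ {k u} (P : StarPacking k) → u ∉ᵛ forbidden P → StarPacking (suc k)
  extend {k} {u} P u∉forbidden = record
    { centre = centre' ; admissible = admissible' ; disjoint = disjoint' }
    where
    u∉fan : u ∉ᵛ fan v
    u∉fan = u∉forbidden ∘ ∈ᵛ-++⁺ˡ _

    new-disjoint : ∀ l → StarsDisjoint u (centre P l) × StarsDisjoint (centre P l) u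
    new-disjoint l = stars-disjoint u∉fan (admissible P l)
                       (u∉forbidden ∘ ∈ᵛ-++⁺ʳ (fan v) ∘ ∈ᵛ-concat⁺ _ l)

    centre' : Fin (suc k) → Fin m
    centre' zero    = u
    centre' (suc l) = centre P l

    admissible' : ∀ l → centre' l ∉ᵛ fan v
    admissible' zero    = u∉fan
    admissible' (suc l) = admissible P l

    disjoint' : ∀ l l' → l ≢ l' → StarsDisjoint (centre' l) (centre' l')
    disjoint' zero    zero     0≢0 = contradiction refl 0≢0
    disjoint' zero    (suc l') _   = proj₁ (new-disjoint l')
    disjoint' (suc l) zero     _   = proj₂ (new-disjoint l)
    disjoint' (suc l) (suc l') l≢l' = disjoint P l l' (l≢l' ∘ cong suc)

  greedy : ∀ k → k * suc (suc n * suc n) ≤ m → StarPacking k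
  greedy zero    _     = record { centre = λ () ; admissible = λ () ; disjoint = λ () }
  greedy (suc k) room =
    let P = greedy k (≤-trans (m≤n+m _ _) room)
    in extend P (proj₂ (∃∉ᵛ room (forbidden P)))

lemma3p1 : (m : ℕ) (S : SteinerTripleSystem m) (c : ℕ) → c ≥ 1 →
    (v : Fin c → Fin m) → Injective _≡_ _≡_ v →
    Σ (Fin (m / (suc (c * c))) → Fin c → Fin m) λ w →
    Σ (Fin (m / (suc (c * c))) → Fin m) λ u →
      (∀ l i → SteinerTripleSystem.Edge S (triple (v i) (w l i) (u l)))
      × (∀ l → Injective _≡_ _≡_ (w l))
      × (∀ l i j → v i ≢ w l j)
      × (∀ l i → u l ≢ v i)
      × (∀ l i → u l ≢ w l i)
      × (∀ l l' → l ≢ l' →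
           (∀ i j → w l i ≢ w l' j) × (∀ i → w l i ≢ u l') × u l ≢ u l')
lemma3p1 m S (suc n) (s≤s z≤n) v v-injective =
  (λ l → leaf (centre l)) , centre ,
  (λ l → leaf-edge (admissible l)) ,
  (λ l → leaf-injective (admissible l)) ,
  (λ l → v≢leaf (admissible l)) ,
  (λ l → centre≢v (admissible l)) ,
  (λ l → centre≢leaf (admissible l)) ,
  disjoint
  where
  open Stars S v v-injective
  open StarPacking (greedy (m / suc (suc n * suc n)) (m/n*n≤m m _))
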